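{- Let $\mathcal{G}$ be a finite simple undirected graph. If $H_1$ and $H_2$ are connected proper F-twins in $\mathcal{G}$ with vertex sets $V_1,V_2$, then $V_1\cap V_2=\emptyset$.
   Context: All graphs are finite, undirected, without loops or parallel edges. For a vertex $u$, $\mathcal{N}(u)$ denotes the set of vertices adjacent to $u$. Two induced subgraphs $H_1,H_2$ of $\mathcal{G}$ with vertex sets $V_1,V_2$ are called F-twins if there is a graph isomorphism $\varphi:V_1\to V_2$ between $H_1$ and $H_2$ such that $\mathcal{N}(u)-V_1=\mathcal{N}(\varphi(u))-V_2$ for all $u\in V_1$. They are proper F-twins if they are F-twins and $H_1\neq H_2$. -}

module Defs where

open import Data.Nat using (ℕ)
open import Data.Fin using (Fin)
open import Data.Fin.Subset using (Subset; _∈_; _∉_)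
open import Data.Bool using (Bool; true; false)
open import Data.Product using (Σ; _×_; _,_; proj₁)
open import Relation.Binary.PropositionalEquality using (_≡_)
open import Function.Bundles using (Bijection; _⇔_)
open import Data.Empty using (⊥)
open import Relation.Binary.PropositionalEquality using (setoid)

record Graph (n : ℕ) : Set where
  field
    adj   : Fin n → Fin n → Bool
    sym   : ∀ u v → adj u v ≡ adj v u
    irrefl : ∀ u → adj u u ≡ false

open Graph public

Adj : ∀ {n} → Graph n → Fin n → Fin n → Set
Adj G u v = adj G u v ≡ true

Vert : ∀ {n} → Subset n → Set
Vert V = Σ (Fin _) (λ u → u ∈ V)

data Walk {n : ℕ} (G : Graph n) (V : Subset n) : Fin n → Fin n → Set where
  here : ∀ {u} → u ∈ V → Walk G V u u
  step : ∀ {u w v} → u ∈ V → Adj G u w → Walk G V w v → Walk G V u v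

Connected : ∀ {n} → Graph n → Subset n → Set
Connected G V = Σ (Fin _) (λ x → x ∈ V) × (∀ u v → u ∈ V → v ∈ V → Walk G V u v)

IsFTwinMap : ∀ {n} → Graph n → (V₁ V₂ : Subset n) → (Vert V₁ → Vert V₂) → Set
IsFTwinMap G V₁ V₂ φ =
    (∀ x y → (Adj G (proj₁ x) (proj₁ y) ⇔ Adj G (proj₁ (φ x)) (proj₁ (φ y))))
  × (∀ x (w : Fin _) →
       ((Adj G (proj₁ x) w × w ∉ V₁) ⇔ (Adj G (proj₁ (φ x)) w × w ∉ V₂)))

FTwins : ∀ {n} → Graph n → Subset n → Subset n → Set
FTwins G V₁ V₂ =
  Σ (Bijection (setoid (Vert V₁)) (setoid (Vert V₂)))
    (λ φ → IsFTwinMap G V₁ V₂ (Bijection.to φ))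

-- Induced subgraphs are determined by their vertex sets, so H₁ ≠ H₂ iff V₁ ≠ V₂.
ProperFTwins : ∀ {n} → Graph n → Subset n → Subset n → Set
ProperFTwins G V₁ V₂ = FTwins G V₁ V₂ × (V₁ ≡ V₂ → ⊥)

module Submission where

-- A vertex lying in both V₁ and V₂ propagates along edges: if u ∈ V₁ ∩ V₂ and
-- w ∈ V₁ is adjacent to u but w ∉ V₂, then w is an external neighbour of u
-- seen from V₂, hence (by the F-twin condition at φ⁻¹ u) an external neighbour
-- seen from V₁, which is absurd; symmetrically for w ∈ V₂.  By connectivity
-- every vertex of V₁ lies in V₂ and vice versa, so V₁ = V₂.

open import Defs
open import Data.Nat using (ℕ)
open import Data.Fin using (Fin)
open import Data.Fin.Subset using (Subset; _∈_; _∉_; _⊆_)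
open import Data.Fin.Subset.Properties using (_∈?_; ⊆-antisym)
open import Data.Product using (_,_; proj₁; proj₂)
open import Relation.Binary.PropositionalEquality as ≡ using (setoid; cong; subst)
open import Relation.Nullary using (yes; no; contradiction)
open import Function.Bundles using (Bijection; module Equivalence)

private
  variable
    n : ℕ
    G : Graph n
    V W : Subset n
    u v : Fin n

AdjClosed : Graph n → Subset n → Subset n → Set
AdjClosed G V W = ∀ {u w} → u ∈ W → w ∈ V → Adj G u w → w ∈ W

walk-start : Walk G V u v → u ∈ V
walk-start (here u∈V)     = u∈V
walk-start (step u∈V _ _) = u∈V

walk-closed : AdjClosed G V W → Walk G V u v → u ∈ W → v ∈ W
walk-closed closed (here _)       u∈W = u∈W
walk-closed closed (step _ a walk) u∈W =
  walk-closed closed walk (closed u∈W (walk-start walk) a)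

connected⇒⊆ : Connected G V → AdjClosed G V W → ∀ {x} → x ∈ V → x ∈ W → V ⊆ W
connected⇒⊆ (_ , walks) closed x∈V x∈W v∈V =
  walk-closed closed (walks _ _ x∈V v∈V) x∈W

module _ (G : Graph n) {V₁ V₂ : Subset n} where

  ftwin-closedˡ : (φ : Vert V₁ → Vert V₂) → IsFTwinMap G V₁ V₂ φ → AdjClosed G V₂ V₁
  ftwin-closedˡ φ (_ , external) {u} u∈V₁ w∈V₂ a with _ ∈? V₁
  ... | yes w∈V₁ = w∈V₁
  ... | no  w∉V₁ =
    contradiction w∈V₂ (proj₂ (Equivalence.to (external (u , u∈V₁) _) (a , w∉V₁)))

  ftwin-closedʳ : (φ : Bijection (setoid (Vert V₁)) (setoid (Vert V₂))) →
                  IsFTwinMap G V₁ V₂ (Bijection.to φ) → AdjClosed G V₁ V₂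
  ftwin-closedʳ φ (_ , external) {u} {w} u∈V₂ w∈V₁ a with w ∈? V₂
  ... | yes w∈V₂ = w∈V₂
  ... | no  w∉V₂ =
    contradiction w∈V₁ (proj₂ (Equivalence.from (external c w) (a′ , w∉V₂)))
    where
    c : Vert V₁
    c = Bijection.to⁻ φ (u , u∈V₂)

    a′ : Adj G (proj₁ (Bijection.to φ c)) w
    a′ = subst (λ v → Adj G v w)
               (≡.sym (cong proj₁ (proj₂ (Bijection.strictlySurjective φ (u , u∈V₂))))) a

corollary1 : ∀ {n : ℕ} (G : Graph n) (V₁ V₂ : Subset n) →
    Connected G V₁ → Connected G V₂ → ProperFTwins G V₁ V₂ →
    ∀ (x : Fin n) → x ∈ V₁ → x ∉ V₂
corollary1 G V₁ V₂ conn₁ conn₂ ((φ , twin) , V₁≢V₂) x x∈V₁ x∈V₂ =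
  V₁≢V₂ (⊆-antisym (connected⇒⊆ conn₁ (ftwin-closedʳ G φ twin) x∈V₁ x∈V₂)
                   (connected⇒⊆ conn₂ (ftwin-closedˡ G (Bijection.to φ) twin) x∈V₂ x∈V₁))
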